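{- Let $r$ be a positive integer, let $F:\mathbf{Set}^r\to\mathbf{Set}$ be a decomposable $r$-sort species with composition operator $\eta$, and let $\Omega_1,\dots,\Omega_m$ be pairwise disjoint objects of $\mathbf{Set}^r$. Then all $\eta$-bracketings of $F[\Omega_1],\dots,F[\Omega_m]$ are equal to each other (as subsets of $F[\Omega_1\amalg\cdots\amalg\Omega_m]$).
   Context: $\mathbf{Set}$ is the category of finite sets and bijections. Objects of $\mathbf{Set}^r$ are $r$-tuples of finite sets; set operations on them are componentwise, and $\boldsymbol\emptyset=(\emptyset,\dots,\emptyset)$. An $r$-sort species is a functor $F:\mathbf{Set}^r\to\mathbf{Set}$. A composition operator for $F$ is a family of injective maps $\eta_{(\Omega_1,\Omega_2)}:F[\Omega_1]\times F[\Omega_2]\to F[\Omega_1\amalg\Omega_2]$, one for each disjoint pair, with the following two properties. - Naturality: $\eta_{(\tilde\Omega_1,\tilde\Omega_2)}\circ(F[f_1]\times F[f_2])=F[f_1\amalg f_2]\circ\eta_{(\Omega_1,\Omega_2)}$ for tuples of bijections $f_i:\Omega_i\to\tilde\Omega_i$. - Axiom (D1): whenever $\Omega_1\amalg\Omega_2=\Omega=\tilde\Omega_1\amalg\tilde\Omega_2$, \[ \eta(F[\Omega_1]\times F[\Omega_2])\cap\eta(F[\tilde\Omega_1]\times F[\tilde\Omega_2])=\eta(\eta(F[\Omega_{11}]\times F[\Omega_{12}])\times\eta(F[\Omega_{21}]\times F[\Omega_{22}])), \] where $\Omega_{ij}=\Omega_i\cap\tilde\Omega_j$. $\eta(A\times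 B)$ is the image of $A\times B$ under the relevant $\eta$-map. $F$ is decomposable if some $F[\Omega]\ne\emptyset$ and $F$ admits a composition operator. $\eta$-bracketings are defined recursively. - For one object, $F[\Omega]$ is an $\eta$-bracketing of $F[\Omega]$. - Suppose $\{i_1,\dots,i_m\}=\{1,\dots,m\}$ and $1\le k\le m-1$. If $B_1$ is an $\eta$-bracketing of $F[\Omega_{i_1}],\dots,F[\Omega_{i_k}]$ and $B_2$ is an $\eta$-bracketing of $F[\Omega_{i_{k+1}}],\dots,F[\Omega_{i_m}]$, then $\eta(B_1\times B_2)$ is an $\eta$-bracketing of $F[\Omega_1],\dots,F[\Omega_m]$. Thus an $\eta$-bracketing applies $\eta$-maps, in any order and with any bracketing, with each $F[\Omega_i]$ occurring exactly once. -}

module Defs where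

open import Data.Nat using (ℕ; zero; suc)
open import Data.Bool using (Bool; true; false; _∨_; _∧_; T)
open import Data.Fin using (Fin; zero; suc)
open import Data.Vec using (Vec; lookup; zipWith; replicate)
open import Data.List using (List; []; _∷_; _++_; allFin)
open import Data.List.Relation.Binary.Permutation.Propositional using (_↭_)
open import Data.Product using (Σ; Σ-syntax; _×_; _,_; proj₁)
open import Data.Unit using (⊤)
open import Function.Bundles using (_↔_; _⇔_; Inverse)
open import Function.Construct.Identity using (↔-id)
open import Function.Construct.Composition using (_↔-∘_)
open import Relation.Binary.PropositionalEquality using (_≡_; refl; subst)

-- Finite subsets of the label set ℕ, in a CANONICAL representation
-- (so that two finite sets are equal iff they are propositionally equal).
-- A finite subset is a bit string with no trailing zeros:
--   empty            = ∅
--   nonempty s       with s : NESub a nonempty bit string ending in 1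
--   top              = {0}
--   cons b s         = (if b then {0} else ∅) ∪ {n+1 | n ∈ s}

data NESub : Set where
  top  : NESub
  cons : Bool → NESub → NESub

data FinSub : Set where
  empty    : FinSub
  nonempty : NESub → FinSub

-- smart constructor (keeps the representation canonical)
consS : Bool → FinSub → FinSub
consS false empty        = empty
consS true  empty        = nonempty top
consS b     (nonempty s) = nonempty (cons b s)

headS : FinSub → Bool
headS empty                 = false
headS (nonempty top)        = true
headS (nonempty (cons b s)) = b

tailS : FinSub → FinSub
tailS empty                 = empty
tailS (nonempty top)        = empty
tailS (nonempty (cons b s)) = nonempty s

_∈ˢ_ : ℕ → FinSub → Bool
zero  ∈ˢ s = headS s
suc n ∈ˢ s = n ∈ˢ tailS s

_∪⁺_ : NESub → NESub → NESub
top      ∪⁺ top      = top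
top      ∪⁺ cons b t = cons true t
cons b s ∪⁺ top      = cons true s
cons b s ∪⁺ cons c t = cons (b ∨ c) (s ∪⁺ t)

_∪ˢ_ : FinSub → FinSub → FinSub
empty      ∪ˢ t          = t
nonempty s ∪ˢ empty      = nonempty s
nonempty s ∪ˢ nonempty t = nonempty (s ∪⁺ t)

_∩⁺_ : NESub → NESub → FinSub
top      ∩⁺ top      = nonempty top
top      ∩⁺ cons b t = consS b empty
cons b s ∩⁺ top      = consS b empty
cons b s ∩⁺ cons c t = consS (b ∧ c) (s ∩⁺ t)

_∩ˢ_ : FinSub → FinSub → FinSub
empty      ∩ˢ t          = empty
nonempty s ∩ˢ empty      = empty
nonempty s ∩ˢ nonempty t = s ∩⁺ t

Elems : FinSub → Set
Elems s = Σ ℕ λ n → T (n ∈ˢ s)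

-- Objects of Set^r : r-tuples of finite sets (of labels from ℕ).
-- Set operations are componentwise.

Obj : ℕ → Set
Obj r = Vec FinSub r

module _ {r : ℕ} where

  ∅ᵒ : Obj r
  ∅ᵒ = replicate r empty

  _∪ᵒ_ : Obj r → Obj r → Obj r
  _∪ᵒ_ = zipWith _∪ˢ_

  _∩ᵒ_ : Obj r → Obj r → Obj r
  _∩ᵒ_ = zipWith _∩ˢ_

  -- Ω₁ and Ω₂ are disjoint (then Ω₁ ∐ Ω₂ is Ω₁ ∪ᵒ Ω₂)
  Disjoint : Obj r → Obj r → Set
  Disjoint Ω₁ Ω₂ = Ω₁ ∩ᵒ Ω₂ ≡ ∅ᵒ

  record Hom (Ω Ω' : Obj r) : Set where
    constructor hom
    field
      bij : (i : Fin r) → Elems (lookup Ω i) ↔ Elems (lookup Ω' i)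
  open Hom public

  _≈ʰ_ : ∀ {Ω Ω'} → Hom Ω Ω' → Hom Ω Ω' → Set
  f ≈ʰ g = ∀ i x → Inverse.to (bij f i) x ≡ Inverse.to (bij g i) x

  idʰ : (Ω : Obj r) → Hom Ω Ω
  idʰ Ω = hom λ i → ↔-id (Elems (lookup Ω i))

  _∘ʰ_ : ∀ {Ω Ω' Ω''} → Hom Ω' Ω'' → Hom Ω Ω' → Hom Ω Ω''
  g ∘ʰ f = hom λ i → bij g i ↔-∘ bij f i

  -- h : Ω₁ ∐ Ω₂ → Ω̃₁ ∐ Ω̃₂ is the bijection f₁ ∐ f₂, i.e. it agrees with
  -- f₁ on Ω₁ and with f₂ on Ω₂ (for disjoint pairs this determines h)
  IsCoprod : ∀ {Ω₁ Ω₂ Ω̃₁ Ω̃₂} → Hom (Ω₁ ∪ᵒ Ω₂) (Ω̃₁ ∪ᵒ Ω̃₂) →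
             Hom Ω₁ Ω̃₁ → Hom Ω₂ Ω̃₂ → Set
  IsCoprod {Ω₁} {Ω₂} h f₁ f₂ =
    (∀ i n (p : T (n ∈ˢ lookup Ω₁ i)) (q : T (n ∈ˢ lookup (Ω₁ ∪ᵒ Ω₂) i)) →
       proj₁ (Inverse.to (bij h i) (n , q)) ≡ proj₁ (Inverse.to (bij f₁ i) (n , p)))
    × (∀ i n (p : T (n ∈ˢ lookup Ω₂ i)) (q : T (n ∈ˢ lookup (Ω₁ ∪ᵒ Ω₂) i)) →
       proj₁ (Inverse.to (bij h i) (n , q)) ≡ proj₁ (Inverse.to (bij f₂ i) (n , p)))

record Species (r : ℕ) : Set₁ where
  field
    F₀     : Obj r → Set
    finite : ∀ Ω → Σ ℕ λ k → F₀ Ω ↔ Fin k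
    F₁     : ∀ {Ω Ω'} → Hom Ω Ω' → F₀ Ω → F₀ Ω'
    F-resp : ∀ {Ω Ω'} {f g : Hom Ω Ω'} → f ≈ʰ g → ∀ x → F₁ f x ≡ F₁ g x
    F-id   : ∀ {Ω} x → F₁ (idʰ Ω) x ≡ x
    F-∘    : ∀ {Ω Ω' Ω''} (f : Hom Ω Ω') (g : Hom Ω' Ω'') x →
             F₁ (g ∘ʰ f) x ≡ F₁ g (F₁ f x)

module _ {r : ℕ} (F : Species r) where
  open Species F

  SubF : Obj r → Set₁
  SubF Ω = F₀ Ω → Set

  AllF : ∀ Ω → SubF Ω
  AllF Ω x = ⊤

  ηImg : (η : ∀ {Ω₁ Ω₂} → Disjoint Ω₁ Ω₂ → F₀ Ω₁ → F₀ Ω₂ → F₀ (Ω₁ ∪ᵒ Ω₂)) →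
         ∀ {Ω₁ Ω₂ Ω} → Disjoint Ω₁ Ω₂ → Ω₁ ∪ᵒ Ω₂ ≡ Ω →
         SubF Ω₁ → SubF Ω₂ → SubF Ω
  ηImg η d e A B x =
    Σ[ a ∈ F₀ _ ] Σ[ b ∈ F₀ _ ] A a × B b × subst F₀ e (η d a b) ≡ x

  record CompositionOperator : Set₁ where
    field
      η      : ∀ {Ω₁ Ω₂} → Disjoint Ω₁ Ω₂ → F₀ Ω₁ → F₀ Ω₂ → F₀ (Ω₁ ∪ᵒ Ω₂)
      η-inj  : ∀ {Ω₁ Ω₂} (d : Disjoint Ω₁ Ω₂) {a a' b b'} →
               η d a b ≡ η d a' b' → a ≡ a' × b ≡ b'
      natural : ∀ {Ω₁ Ω₂ Ω̃₁ Ω̃₂} (d : Disjoint Ω₁ Ω₂) (d̃ : Disjoint Ω̃₁ Ω̃₂)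
                (f₁ : Hom Ω₁ Ω̃₁) (f₂ : Hom Ω₂ Ω̃₂)
                (h : Hom (Ω₁ ∪ᵒ Ω₂) (Ω̃₁ ∪ᵒ Ω̃₂)) → IsCoprod h f₁ f₂ →
                ∀ a b → η d̃ (F₁ f₁ a) (F₁ f₂ b) ≡ F₁ h (η d a b)
      D1 : ∀ {Ω Ω₁ Ω₂ Ω̃₁ Ω̃₂}
           (d : Disjoint Ω₁ Ω₂) (e : Ω₁ ∪ᵒ Ω₂ ≡ Ω)
           (d̃ : Disjoint Ω̃₁ Ω̃₂) (ẽ : Ω̃₁ ∪ᵒ Ω̃₂ ≡ Ω)
           (d₁ : Disjoint (Ω₁ ∩ᵒ Ω̃₁) (Ω₁ ∩ᵒ Ω̃₂))
           (d₂ : Disjoint (Ω₂ ∩ᵒ Ω̃₁) (Ω₂ ∩ᵒ Ω̃₂))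
           (d₃ : Disjoint ((Ω₁ ∩ᵒ Ω̃₁) ∪ᵒ (Ω₁ ∩ᵒ Ω̃₂))
                          ((Ω₂ ∩ᵒ Ω̃₁) ∪ᵒ (Ω₂ ∩ᵒ Ω̃₂)))
           (e₃ : ((Ω₁ ∩ᵒ Ω̃₁) ∪ᵒ (Ω₁ ∩ᵒ Ω̃₂)) ∪ᵒ ((Ω₂ ∩ᵒ Ω̃₁) ∪ᵒ (Ω₂ ∩ᵒ Ω̃₂)) ≡ Ω)
           (x : F₀ Ω) →
           (ηImg η d e (AllF _) (AllF _) x × ηImg η d̃ ẽ (AllF _) (AllF _) x)
           ⇔ ηImg η d₃ e₃ (ηImg η d₁ refl (AllF _) (AllF _))
                          (ηImg η d₂ refl (AllF _) (AllF _)) x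

  -- F is decomposable (relative to the given composition operator):
  -- some F[Ω] is nonempty
  Nonempty : Set
  Nonempty = Σ (Obj r) F₀

-- η-bracketings: binary trees whose leaves are labelled by 1..m,
-- each index occurring exactly once.

data Tree (m : ℕ) : Set where
  leaf : Fin m → Tree m
  node : Tree m → Tree m → Tree m

leaves : ∀ {m} → Tree m → List (Fin m)
leaves (leaf i)   = i ∷ []
leaves (node s t) = leaves s ++ leaves t

IsBracketing : ∀ {m} → Tree m → Set
IsBracketing {m} t = leaves t ↭ allFin m

⋃ᵒ : ∀ {r} m → (Fin m → Obj r) → Obj r
⋃ᵒ zero    Ω = ∅ᵒ
⋃ᵒ (suc m) Ω = Ω zero ∪ᵒ ⋃ᵒ m (λ i → Ω (suc i))

module _ {r m : ℕ} (F : Species r) (C : CompositionOperator F)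
         (Ω : Fin m → Obj r) where
  open Species F
  open CompositionOperator C

  Uᵗ : Tree m → Obj r
  Uᵗ (leaf i)   = Ω i
  Uᵗ (node s t) = Uᵗ s ∪ᵒ Uᵗ t

  Bracket : (t : Tree m) → SubF F (Uᵗ t)
  Bracket (leaf i)   = AllF F (Ω i)
  Bracket (node s t) x =
    Σ[ d ∈ Disjoint (Uᵗ s) (Uᵗ t) ] ηImg F η d refl (Bracket s) (Bracket t) x

  BracketIn : (t : Tree m) → Uᵗ t ≡ ⋃ᵒ m Ω → SubF F (⋃ᵒ m Ω)
  BracketIn t e x = Σ[ y ∈ F₀ (Uᵗ t) ] Bracket t y × subst F₀ e y ≡ x

module Submission where

-- Idea: every bracketing equals one tree-independent subset of F[Ω₁ ∐ ⋯ ∐ Ωₘ],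
-- namely the elements x that split along every Ωⱼ, i.e. x ∈ η(F[X ∩ Ωⱼ] ×
-- F[X ∖ Ωⱼ]) for all j.  Elements of a bracketing split: at a leaf one piece is
-- empty, and given a point z ∈ F[∅] the injection η(-, z) of the finite set
-- F[A] into itself is onto; at a node the splittings of the two factors are
-- combined by axiom (D1).  Conversely a splitting element of F[U t] splits
-- along the object of the left subtree of t (induction on that subtree, again
-- by (D1)), which recovers the node, and the factors split in turn.  A point
-- of F[∅] is always available when the bracket is a proper product: (D1)
-- applied to a decomposition and itself yields an element of F[A ∩ B] = F[∅].

open import Defs
open import Data.Nat using (ℕ; zero; suc; _≤_; s≤s; z≤n; _+_)
open import Data.Nat.Properties using (n≮n; 1+n≰n; ≤-trans; m≤m+n; +-mono-≤; module ≤-Reasoning)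
open import Data.Bool using (Bool; true; false; _∨_; _∧_; not)
open import Data.Bool.Properties using (∨-zeroʳ; ∨-identityʳ; ∧-zeroʳ; ∧-identityʳ; ∧-idem)
  renaming (_≟_ to _≟ᵇ_)
open import Data.Fin using (Fin; zero; suc; punchOut)
open import Data.Fin.Properties using (any?; punchOut-injective; injective⇒≤) renaming (_≟_ to _≟ᶠ_)
open import Data.Vec using (Vec; []; _∷_; lookup; zipWith; tabulate)
open import Data.Vec.Properties
  using (lookup-zipWith; lookup-replicate; tabulate∘lookup; tabulate-cong; lookup∘tabulate; ≡-dec)
open import Data.List using (List; []; _∷_; _++_; length)
open import Data.List.Properties using (length-++; length-tabulate)
open import Data.List.Relation.Unary.All as All using (All; []; _∷_; all?)
open import Data.List.Relation.Unary.All.Properties using (++⁻ˡ; ++⁻ʳ)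
open import Data.List.Relation.Unary.AllPairs using (AllPairs; []; _∷_)
open import Data.List.Relation.Unary.Unique.Propositional.Properties using (allFin⁺)
open import Data.List.Relation.Binary.Permutation.Propositional using (↭-sym; ↭⇒↭ₛ)
open import Data.List.Relation.Binary.Permutation.Propositional.Properties using (↭-length)
open import Data.List.Relation.Binary.Permutation.Setoid.Properties using (AllPairs-resp-↭)
open import Data.Product using (Σ; _×_; _,_; proj₁; proj₂)
open import Data.Unit using (⊤; tt)
open import Data.Empty using (⊥; ⊥-elim)
open import Relation.Nullary using (Dec; yes; no)
open import Relation.Nullary.Decidable using (True; toWitness; map′; _×-dec_; _→-dec_)
open import Relation.Binary.Definitions using (DecidableEquality)
open import Relation.Binary.PropositionalEquality
open import Function.Bundles using (_↔_; _⇔_; mk⇔; Inverse; Equivalence)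
import Axiom.UniquenessOfIdentityProofs as UIP
open import Function using (_∘_; id)

∈-empty : ∀ n → n ∈ˢ empty ≡ false
∈-empty zero    = refl
∈-empty (suc n) = ∈-empty n

headS-consS : ∀ b u → headS (consS b u) ≡ b
headS-consS false empty        = refl
headS-consS true  empty        = refl
headS-consS false (nonempty s) = refl
headS-consS true  (nonempty s) = refl

tailS-consS : ∀ b u → tailS (consS b u) ≡ u
tailS-consS false empty        = refl
tailS-consS true  empty        = refl
tailS-consS false (nonempty s) = refl
tailS-consS true  (nonempty s) = refl

∈-∪⁺ : ∀ s t n → n ∈ˢ nonempty (s ∪⁺ t) ≡ (n ∈ˢ nonempty s) ∨ (n ∈ˢ nonempty t)
∈-∪⁺ top        top        zero    = refl
∈-∪⁺ top        top        (suc n) rewrite ∈-empty n = refl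
∈-∪⁺ top        (cons b t) zero    = refl
∈-∪⁺ top        (cons b t) (suc n) rewrite ∈-empty n = refl
∈-∪⁺ (cons b s) top        zero    = sym (∨-zeroʳ b)
∈-∪⁺ (cons b s) top        (suc n) rewrite ∈-empty n = sym (∨-identityʳ _)
∈-∪⁺ (cons b s) (cons c t) zero    = refl
∈-∪⁺ (cons b s) (cons c t) (suc n) = ∈-∪⁺ s t n

∈-∪ : ∀ s t n → n ∈ˢ (s ∪ˢ t) ≡ (n ∈ˢ s) ∨ (n ∈ˢ t)
∈-∪ empty        t            n rewrite ∈-empty n = refl
∈-∪ (nonempty s) empty        n rewrite ∈-empty n = sym (∨-identityʳ _)
∈-∪ (nonempty s) (nonempty t) n = ∈-∪⁺ s t n

∈-∩⁺ : ∀ s t n → n ∈ˢ (s ∩⁺ t) ≡ (n ∈ˢ nonempty s) ∧ (n ∈ˢ nonempty t)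
∈-∩⁺ top        top        n       = sym (∧-idem _)
∈-∩⁺ top        (cons b t) zero    = headS-consS b empty
∈-∩⁺ top        (cons b t) (suc n) rewrite tailS-consS b empty | ∈-empty n = refl
∈-∩⁺ (cons b s) top        zero    rewrite headS-consS b empty = sym (∧-identityʳ b)
∈-∩⁺ (cons b s) top        (suc n) rewrite tailS-consS b empty | ∈-empty n = sym (∧-zeroʳ _)
∈-∩⁺ (cons b s) (cons c t) zero    = headS-consS (b ∧ c) _
∈-∩⁺ (cons b s) (cons c t) (suc n) rewrite tailS-consS (b ∧ c) (s ∩⁺ t) = ∈-∩⁺ s t n

∈-∩ : ∀ s t n → n ∈ˢ (s ∩ˢ t) ≡ (n ∈ˢ s) ∧ (n ∈ˢ t)
∈-∩ empty        t            n rewrite ∈-empty n = refl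
∈-∩ (nonempty s) empty        n rewrite ∈-empty n = sym (∧-zeroʳ _)
∈-∩ (nonempty s) (nonempty t) n = ∈-∩⁺ s t n

_∖⁺_ : NESub → FinSub → FinSub
top      ∖⁺ t = consS (not (headS t)) empty
cons b s ∖⁺ t = consS (b ∧ not (headS t)) (s ∖⁺ tailS t)

_∖ˢ_ : FinSub → FinSub → FinSub
empty      ∖ˢ t = empty
nonempty s ∖ˢ t = s ∖⁺ t

∈-∖⁺ : ∀ s t n → n ∈ˢ (s ∖⁺ t) ≡ (n ∈ˢ nonempty s) ∧ not (n ∈ˢ t)
∈-∖⁺ top        t zero    = headS-consS _ empty
∈-∖⁺ top        t (suc n) rewrite tailS-consS (not (headS t)) empty | ∈-empty n = refl
∈-∖⁺ (cons b s) t zero    = headS-consS _ _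
∈-∖⁺ (cons b s) t (suc n) rewrite tailS-consS (b ∧ not (headS t)) (s ∖⁺ tailS t) = ∈-∖⁺ s (tailS t) n

∈-∖ : ∀ s t n → n ∈ˢ (s ∖ˢ t) ≡ (n ∈ˢ s) ∧ not (n ∈ˢ t)
∈-∖ empty        t n rewrite ∈-empty n = refl
∈-∖ (nonempty s) t n = ∈-∖⁺ s t n

witness : ∀ s → Σ ℕ λ n → n ∈ˢ nonempty s ≡ true
witness top        = zero , refl
witness (cons b s) with n , p ← witness s = suc n , p

∉-empty : ∀ n → n ∈ˢ empty ≡ true → ⊥
∉-empty n p with trans (sym (∈-empty n)) p
... | ()

∈-ext⁺ : ∀ s t → (∀ n → n ∈ˢ nonempty s ≡ n ∈ˢ nonempty t) → s ≡ t
∈-ext⁺ top        top        h = refl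
∈-ext⁺ top        (cons b t) h with n , p ← witness t = ⊥-elim (∉-empty n (trans (h (suc n)) p))
∈-ext⁺ (cons b s) top        h with n , p ← witness s = ⊥-elim (∉-empty n (trans (sym (h (suc n))) p))
∈-ext⁺ (cons b s) (cons c t) h = cong₂ cons (h zero) (∈-ext⁺ s t (λ n → h (suc n)))

∈-ext : ∀ s t → (∀ n → n ∈ˢ s ≡ n ∈ˢ t) → s ≡ t
∈-ext empty        empty        h = refl
∈-ext empty        (nonempty t) h with n , p ← witness t = ⊥-elim (∉-empty n (trans (h n) p))
∈-ext (nonempty s) empty        h with n , p ← witness s = ⊥-elim (∉-empty n (trans (sym (h n)) p))
∈-ext (nonempty s) (nonempty t) h = cong nonempty (∈-ext⁺ s t h)

module _ {r : ℕ} where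

  _∖ᵒ_ : Obj r → Obj r → Obj r
  _∖ᵒ_ = zipWith _∖ˢ_

  _∈[_]_ : ℕ → Fin r → Obj r → Bool
  n ∈[ k ] A = n ∈ˢ lookup A k

  ∈ᵒ-ext : ∀ A B → (∀ k n → n ∈[ k ] A ≡ n ∈[ k ] B) → A ≡ B
  ∈ᵒ-ext A B h = trans (sym (tabulate∘lookup A))
    (trans (tabulate-cong (λ k → ∈-ext _ _ (h k))) (tabulate∘lookup B))

  ∈ᵒ-∅ : ∀ k n → n ∈[ k ] ∅ᵒ {r} ≡ false
  ∈ᵒ-∅ k n rewrite lookup-replicate k empty = ∈-empty n

  ∈ᵒ-∪ : ∀ k n A B → n ∈[ k ] (A ∪ᵒ B) ≡ n ∈[ k ] A ∨ n ∈[ k ] B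
  ∈ᵒ-∪ k n A B rewrite lookup-zipWith _∪ˢ_ k A B = ∈-∪ _ _ n

  ∈ᵒ-∩ : ∀ k n A B → n ∈[ k ] (A ∩ᵒ B) ≡ n ∈[ k ] A ∧ n ∈[ k ] B
  ∈ᵒ-∩ k n A B rewrite lookup-zipWith _∩ˢ_ k A B = ∈-∩ _ _ n

  ∈ᵒ-∖ : ∀ k n A B → n ∈[ k ] (A ∖ᵒ B) ≡ n ∈[ k ] A ∧ not (n ∈[ k ] B)
  ∈ᵒ-∖ k n A B rewrite lookup-zipWith _∖ˢ_ k A B = ∈-∖ _ _ n

-- Boolean-algebra identities between objects, decided by truth tables.
-- An identity between set expressions that holds in Bool under all
-- assignments satisfying given hypotheses holds for objects satisfying them,
-- because every label evaluates both sides pointwise.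
infixl 7 _∩ₑ_
infixl 6 _∪ₑ_ _∖ₑ_

data Expr (N : ℕ) : Set where
  var           : Fin N → Expr N
  ∅ₑ            : Expr N
  _∪ₑ_ _∩ₑ_ _∖ₑ_ : Expr N → Expr N → Expr N

v₀ : ∀ {N} → Expr (suc N)
v₀ = var zero
v₁ : ∀ {N} → Expr (suc (suc N))
v₁ = var (suc zero)
v₂ : ∀ {N} → Expr (suc (suc (suc N)))
v₂ = var (suc (suc zero))
v₃ : ∀ {N} → Expr (suc (suc (suc (suc N))))
v₃ = var (suc (suc (suc zero)))
v₄ : ∀ {N} → Expr (suc (suc (suc (suc (suc N)))))
v₄ = var (suc (suc (suc (suc zero))))

⟦_⟧ᵇ : ∀ {N} → Expr N → Vec Bool N → Bool
⟦ var i  ⟧ᵇ σ = lookup σ i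
⟦ ∅ₑ     ⟧ᵇ σ = false
⟦ a ∪ₑ b ⟧ᵇ σ = ⟦ a ⟧ᵇ σ ∨ ⟦ b ⟧ᵇ σ
⟦ a ∩ₑ b ⟧ᵇ σ = ⟦ a ⟧ᵇ σ ∧ ⟦ b ⟧ᵇ σ
⟦ a ∖ₑ b ⟧ᵇ σ = ⟦ a ⟧ᵇ σ ∧ not (⟦ b ⟧ᵇ σ)

⟦_⟧ᵒ : ∀ {r N} → Expr N → Vec (Obj r) N → Obj r
⟦ var i  ⟧ᵒ ρ = lookup ρ i
⟦ ∅ₑ     ⟧ᵒ ρ = ∅ᵒ
⟦ a ∪ₑ b ⟧ᵒ ρ = ⟦ a ⟧ᵒ ρ ∪ᵒ ⟦ b ⟧ᵒ ρ
⟦ a ∩ₑ b ⟧ᵒ ρ = ⟦ a ⟧ᵒ ρ ∩ᵒ ⟦ b ⟧ᵒ ρ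
⟦ a ∖ₑ b ⟧ᵒ ρ = ⟦ a ⟧ᵒ ρ ∖ᵒ ⟦ b ⟧ᵒ ρ

Equations : ℕ → Set
Equations N = List (Expr N × Expr N)

Satisfiedᵇ : ∀ {N} → Vec Bool N → Expr N × Expr N → Set
Satisfiedᵇ σ (a , b) = ⟦ a ⟧ᵇ σ ≡ ⟦ b ⟧ᵇ σ

Satisfiedᵒ : ∀ {r N} → Vec (Obj r) N → Expr N × Expr N → Set
Satisfiedᵒ ρ (a , b) = ⟦ a ⟧ᵒ ρ ≡ ⟦ b ⟧ᵒ ρ

Entails : ∀ {N} → Equations N → Expr N × Expr N → Set
Entails {N} hs goal = (σ : Vec Bool N) → All (Satisfiedᵇ σ) hs → Satisfiedᵇ σ goal

all-assignments? : ∀ N {P : Vec Bool N → Set} → (∀ σ → Dec (P σ)) → Dec (∀ σ → P σ)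
all-assignments? zero    P? = map′ (λ { p [] → p }) (λ h → h []) (P? [])
all-assignments? (suc N) P? =
  map′ (λ { (t , f) (true ∷ σ) → t σ ; (t , f) (false ∷ σ) → f σ })
       (λ h → (λ σ → h (true ∷ σ)) , (λ σ → h (false ∷ σ)))
       (all-assignments? N (λ σ → P? (true ∷ σ)) ×-dec all-assignments? N (λ σ → P? (false ∷ σ)))

entails? : ∀ {N} (hs : Equations N) (goal : Expr N × Expr N) → Dec (Entails hs goal)
entails? {N} hs (a , b) = all-assignments? N λ σ →
  all? (λ { (c , d) → ⟦ c ⟧ᵇ σ ≟ᵇ ⟦ d ⟧ᵇ σ }) hs →-dec (⟦ a ⟧ᵇ σ ≟ᵇ ⟦ b ⟧ᵇ σ)

module _ {r N : ℕ} (ρ : Vec (Obj r) N) where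

  assignmentAt : Fin r → ℕ → Vec Bool N
  assignmentAt k n = tabulate (λ i → n ∈[ k ] lookup ρ i)

  ∈-⟦⟧ : ∀ k n e → n ∈[ k ] ⟦ e ⟧ᵒ ρ ≡ ⟦ e ⟧ᵇ (assignmentAt k n)
  ∈-⟦⟧ k n (var i)  = sym (lookup∘tabulate _ i)
  ∈-⟦⟧ k n ∅ₑ       = ∈ᵒ-∅ k n
  ∈-⟦⟧ k n (a ∪ₑ b) = trans (∈ᵒ-∪ k n (⟦ a ⟧ᵒ ρ) (⟦ b ⟧ᵒ ρ)) (cong₂ _∨_ (∈-⟦⟧ k n a) (∈-⟦⟧ k n b))
  ∈-⟦⟧ k n (a ∩ₑ b) = trans (∈ᵒ-∩ k n (⟦ a ⟧ᵒ ρ) (⟦ b ⟧ᵒ ρ)) (cong₂ _∧_ (∈-⟦⟧ k n a) (∈-⟦⟧ k n b))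
  ∈-⟦⟧ k n (a ∖ₑ b) = trans (∈ᵒ-∖ k n (⟦ a ⟧ᵒ ρ) (⟦ b ⟧ᵒ ρ)) (cong₂ (λ x y → x ∧ not y) (∈-⟦⟧ k n a) (∈-⟦⟧ k n b))

  satisfiedAt : ∀ k n eq → Satisfiedᵒ ρ eq → Satisfiedᵇ (assignmentAt k n) eq
  satisfiedAt k n (a , b) p = trans (sym (∈-⟦⟧ k n a)) (trans (cong (n ∈[ k ]_) p) (∈-⟦⟧ k n b))

-- The proofs it
-- produces only matter through their types, so solve is opaque; this keeps
-- typechecking from unfolding them during unification.
opaque
  solve : ∀ {r N} (hs : Equations N) (a b : Expr N) → True (entails? hs (a , b)) →
          (ρ : Vec (Obj r) N) → All (Satisfiedᵒ ρ) hs → ⟦ a ⟧ᵒ ρ ≡ ⟦ b ⟧ᵒ ρ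
  solve hs a b valid ρ h = ∈ᵒ-ext _ _ λ k n →
    trans (∈-⟦⟧ ρ k n a)
      (trans (toWitness valid (assignmentAt ρ k n) (All.map (λ {eq} → satisfiedAt ρ k n eq) h))
             (sym (∈-⟦⟧ ρ k n b)))

-- Objects have decidable equality, hence unique identity proofs: the
-- disjointness and union proofs carried around by η are irrelevant.
_≟ⁿ_ : DecidableEquality NESub
top      ≟ⁿ top      = yes refl
top      ≟ⁿ cons _ _ = no λ ()
cons _ _ ≟ⁿ top      = no λ ()
cons b s ≟ⁿ cons c t with b ≟ᵇ c | s ≟ⁿ t
... | yes refl | yes refl = yes refl
... | no b≢c   | _        = no λ { refl → b≢c refl }
... | _        | no s≢t   = no λ { refl → s≢t refl }

_≟ˢ_ : DecidableEquality FinSub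
empty      ≟ˢ empty      = yes refl
empty      ≟ˢ nonempty _ = no λ ()
nonempty _ ≟ˢ empty      = no λ ()
nonempty s ≟ˢ nonempty t with s ≟ⁿ t
... | yes refl = yes refl
... | no s≢t   = no λ { refl → s≢t refl }

Obj-uip : ∀ {r} {A B : Obj r} (p q : A ≡ B) → p ≡ q
Obj-uip = UIP.Decidable⇒UIP.≡-irrelevant (≡-dec _≟ˢ_)

injective⇒surjective-Fin : ∀ k (h : Fin k → Fin k) → (∀ {a b} → h a ≡ h b → a ≡ b) →
                           ∀ y → Σ (Fin k) λ x → h x ≡ y
injective⇒surjective-Fin k h inj y with any? (λ x → h x ≟ᶠ y)
... | yes hit = hit
injective⇒surjective-Fin (suc k) h inj y | no miss =
  ⊥-elim (n≮n k (injective⇒≤ {f = avoid} (λ eq → inj (punchOut-injective (misses _) (misses _) eq))))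
  where
  misses : ∀ x → y ≢ h x
  misses x y≡hx = miss (x , sym y≡hx)
  avoid : Fin (suc k) → Fin k
  avoid x = punchOut (misses x)

injective⇒surjective : ∀ {A : Set} → (Σ ℕ λ k → A ↔ Fin k) → (g : A → A) →
                       (∀ {a b} → g a ≡ g b → a ≡ b) → ∀ y → Σ A λ a → g a ≡ y
injective⇒surjective (k , iso) g inj y = from (proj₁ hit) , to-inj (proj₂ hit)
  where
  open Inverse iso
  to-inj : ∀ {a b} → to a ≡ to b → a ≡ b
  to-inj {a} {b} eq = trans (sym (strictlyInverseʳ a)) (trans (cong from eq) (strictlyInverseʳ b))
  from-inj : ∀ {a b} → from a ≡ from b → a ≡ b
  from-inj {a} {b} eq = trans (sym (strictlyInverseˡ a)) (trans (cong to eq) (strictlyInverseˡ b))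
  hit : Σ (Fin k) λ x → to (g (from x)) ≡ to y
  hit = injective⇒surjective-Fin k (to ∘ g ∘ from) (λ eq → from-inj (inj (to-inj eq))) (to y)

module _ {r : ℕ} where

  _⊆ᵒ_ : Obj r → Obj r → Set
  A ⊆ᵒ B = A ∩ᵒ B ≡ A

  cut-disjoint : ∀ (X W : Obj r) → Disjoint (X ∩ᵒ W) (X ∖ᵒ W)
  cut-disjoint X W = solve [] ((v₀ ∩ₑ v₁) ∩ₑ (v₀ ∖ₑ v₁)) ∅ₑ tt (X ∷ W ∷ []) []

  cut-cover : ∀ (X W : Obj r) → (X ∩ᵒ W) ∪ᵒ (X ∖ᵒ W) ≡ X
  cut-cover X W = solve [] ((v₀ ∩ₑ v₁) ∪ₑ (v₀ ∖ₑ v₁)) v₀ tt (X ∷ W ∷ []) []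

  ∩-idem : ∀ (X : Obj r) → X ∩ᵒ X ≡ X
  ∩-idem X = solve [] (v₀ ∩ₑ v₀) v₀ tt (X ∷ []) []

  ∖-self : ∀ (X : Obj r) → X ∖ᵒ X ≡ ∅ᵒ
  ∖-self X = solve [] (v₀ ∖ₑ v₀) ∅ₑ tt (X ∷ []) []

  ∖-disjoint : ∀ (X W : Obj r) → Disjoint X W → X ∖ᵒ W ≡ X
  ∖-disjoint X W d = solve ((v₀ ∩ₑ v₁ , ∅ₑ) ∷ []) (v₀ ∖ₑ v₁) v₀ tt (X ∷ W ∷ []) (d ∷ [])

  ∪-∖ˡ : ∀ (S T : Obj r) → Disjoint S T → (S ∪ᵒ T) ∖ᵒ S ≡ T
  ∪-∖ˡ S T d = solve ((v₀ ∩ₑ v₁ , ∅ₑ) ∷ []) ((v₀ ∪ₑ v₁) ∖ₑ v₀) v₁ tt (S ∷ T ∷ []) (d ∷ [])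

  ∪-disjointˡ : ∀ (S T W : Obj r) → Disjoint S W → Disjoint T W → Disjoint (S ∪ᵒ T) W
  ∪-disjointˡ S T W dS dT =
    solve ((v₀ ∩ₑ v₂ , ∅ₑ) ∷ (v₁ ∩ₑ v₂ , ∅ₑ) ∷ []) ((v₀ ∪ₑ v₁) ∩ₑ v₂) ∅ₑ tt (S ∷ T ∷ W ∷ []) (dS ∷ dT ∷ [])

  ∪-disjointʳ : ∀ (S T W : Obj r) → Disjoint W S → Disjoint W T → Disjoint W (S ∪ᵒ T)
  ∪-disjointʳ S T W dS dT =
    solve ((v₂ ∩ₑ v₀ , ∅ₑ) ∷ (v₂ ∩ₑ v₁ , ∅ₑ) ∷ []) (v₂ ∩ₑ (v₀ ∪ₑ v₁)) ∅ₑ tt (S ∷ T ∷ W ∷ []) (dS ∷ dT ∷ [])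

  ⊆-∪ˡ : ∀ (S T : Obj r) → S ⊆ᵒ (S ∪ᵒ T)
  ⊆-∪ˡ S T = solve [] (v₀ ∩ₑ (v₀ ∪ₑ v₁)) v₀ tt (S ∷ T ∷ []) []

  ∪-⊆⁻ : ∀ (S T X : Obj r) → (S ∪ᵒ T) ⊆ᵒ X → S ⊆ᵒ X × T ⊆ᵒ X
  ∪-⊆⁻ S T X sub =
    solve hyp (v₀ ∩ₑ v₂) v₀ tt (S ∷ T ∷ X ∷ []) (sub ∷ []) ,
    solve hyp (v₁ ∩ₑ v₂) v₁ tt (S ∷ T ∷ X ∷ []) (sub ∷ [])
    where
    hyp : Equations 3
    hyp = ((v₀ ∪ₑ v₁) ∩ₑ v₂ , v₀ ∪ₑ v₁) ∷ []

  ⊆⇒∩-swap : ∀ (W X : Obj r) → W ⊆ᵒ X → X ∩ᵒ W ≡ W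
  ⊆⇒∩-swap W X sub = solve ((v₀ ∩ₑ v₁ , v₀) ∷ []) (v₁ ∩ₑ v₀) v₀ tt (W ∷ X ∷ []) (sub ∷ [])

  cut-restrictˡ : ∀ (S T W : Obj r) → S ∩ᵒ W ≡ S ∩ᵒ ((S ∪ᵒ T) ∩ᵒ W) × S ∖ᵒ W ≡ S ∩ᵒ ((S ∪ᵒ T) ∖ᵒ W)
  cut-restrictˡ S T W =
    solve [] (v₀ ∩ₑ v₂) (v₀ ∩ₑ ((v₀ ∪ₑ v₁) ∩ₑ v₂)) tt (S ∷ T ∷ W ∷ []) [] ,
    solve [] (v₀ ∖ₑ v₂) (v₀ ∩ₑ ((v₀ ∪ₑ v₁) ∖ₑ v₂)) tt (S ∷ T ∷ W ∷ []) []

  cut-restrictʳ : ∀ (S T W : Obj r) → T ∩ᵒ W ≡ T ∩ᵒ ((S ∪ᵒ T) ∩ᵒ W) × T ∖ᵒ W ≡ T ∩ᵒ ((S ∪ᵒ T) ∖ᵒ W)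
  cut-restrictʳ S T W =
    solve [] (v₁ ∩ₑ v₂) (v₁ ∩ₑ ((v₀ ∪ₑ v₁) ∩ₑ v₂)) tt (S ∷ T ∷ W ∷ []) [] ,
    solve [] (v₁ ∖ₑ v₂) (v₁ ∩ₑ ((v₀ ∪ₑ v₁) ∖ₑ v₂)) tt (S ∷ T ∷ W ∷ []) []

  cut-complement : ∀ (S T X : Obj r) → (X ∖ᵒ S) ∩ᵒ T ≡ (X ∖ᵒ S) ∩ᵒ (S ∪ᵒ T)
                             × (X ∖ᵒ S) ∩ᵒ (X ∖ᵒ T) ≡ (X ∖ᵒ S) ∩ᵒ (X ∖ᵒ (S ∪ᵒ T))
  cut-complement S T X =
    solve [] ((v₂ ∖ₑ v₀) ∩ₑ v₁) ((v₂ ∖ₑ v₀) ∩ₑ (v₀ ∪ₑ v₁)) tt (S ∷ T ∷ X ∷ []) [] ,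
    solve [] ((v₂ ∖ₑ v₀) ∩ₑ (v₂ ∖ₑ v₁)) ((v₂ ∖ₑ v₀) ∩ₑ (v₂ ∖ₑ (v₀ ∪ₑ v₁))) tt (S ∷ T ∷ X ∷ []) []

  ∩-∖-∪ : ∀ (S T X : Obj r) → S ∩ᵒ (X ∖ᵒ (S ∪ᵒ T)) ≡ ∅ᵒ
  ∩-∖-∪ S T X = solve [] (v₀ ∩ₑ (v₂ ∖ₑ (v₀ ∪ₑ v₁))) ∅ₑ tt (S ∷ T ∷ X ∷ []) []

  complement-disjoint : ∀ (Y X : Obj r) → Disjoint Y (X ∖ᵒ Y)
  complement-disjoint Y X = solve [] (v₀ ∩ₑ (v₁ ∖ₑ v₀)) ∅ₑ tt (Y ∷ X ∷ []) []

  complement-cover : ∀ (Y X : Obj r) → Y ⊆ᵒ X → Y ∪ᵒ (X ∖ᵒ Y) ≡ X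
  complement-cover Y X sub = solve ((v₀ ∩ₑ v₁ , v₀) ∷ []) (v₀ ∪ₑ (v₁ ∖ₑ v₀)) v₁ tt (Y ∷ X ∷ []) (sub ∷ [])

-- Any bracketing of F[Ω₁], …, F[Ωₘ] has exactly m leaves, so a single leaf
-- and a proper bracket can only both be bracketings of the same family if
-- 1 = m ≥ 2.
bracketing-size : ∀ {m} {t : Tree m} → IsBracketing t → length (leaves t) ≡ m
bracketing-size b = trans (↭-length b) (length-tabulate id)

leaves-nonempty : ∀ {m} (t : Tree m) → 1 ≤ length (leaves t)
leaves-nonempty (leaf i)   = s≤s z≤n
leaves-nonempty (node s t) rewrite length-++ (leaves s) {leaves t} =
  ≤-trans (leaves-nonempty s) (m≤m+n _ _)

leaf-node-bracketings : ∀ {m i} {s t : Tree m} → IsBracketing (leaf i) → IsBracketing (node s t) → ⊥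
leaf-node-bracketings {s = s} {t} bl bn = 1+n≰n two≤one
  where
  two≤one : 2 ≤ 1
  two≤one = begin
    2                                       ≤⟨ +-mono-≤ (leaves-nonempty s) (leaves-nonempty t) ⟩
    length (leaves s) + length (leaves t)   ≡⟨ sym (length-++ (leaves s)) ⟩
    length (leaves (node s t))              ≡⟨ trans (bracketing-size {t = node s t} bn) (sym (bracketing-size {t = leaf _} bl)) ⟩
    1                                       ∎
    where open ≤-Reasoning

AllPairs-++⁻ : ∀ {A : Set} {R : A → A → Set} (xs : List A) {ys} → AllPairs R (xs ++ ys) →
               AllPairs R xs × AllPairs R ys × All (λ x → All (R x) ys) xs
AllPairs-++⁻ []       all-ys = [] , all-ys , []
AllPairs-++⁻ (x ∷ xs) (x-ys ∷ rest) with xs-p , ys-p , cross ← AllPairs-++⁻ xs rest =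
  ++⁻ˡ xs x-ys ∷ xs-p , ys-p , ++⁻ʳ xs x-ys ∷ cross

module CompositionFacts {r : ℕ} (F : Species r) (C : CompositionOperator F) where
  open Species F
  open CompositionOperator C

  ηₓ : ∀ {A B X} → Disjoint A B → A ∪ᵒ B ≡ X → F₀ A → F₀ B → F₀ X
  ηₓ d e a b = subst F₀ e (η d a b)

  Im : (A B X : Obj r) → F₀ X → Set
  Im A B X x = Σ (Disjoint A B) λ d → Σ (A ∪ᵒ B ≡ X) λ e →
               Σ (F₀ A) λ a → Σ (F₀ B) λ b → ηₓ d e a b ≡ x

  Im-cong : ∀ {A B A' B' X x} → A ≡ A' × B ≡ B' → Im A B X x → Im A' B' X x
  Im-cong (refl , refl) im = im

  Im-cong⁻ : ∀ {A B A' B' X x} → A ≡ A' × B ≡ B' → Im A' B' X x → Im A B X x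
  Im-cong⁻ (refl , refl) im = im

  ηₓ-injective : ∀ {A B X} (d : Disjoint A B) (e : A ∪ᵒ B ≡ X) {a a' b b'} →
                 ηₓ d e a b ≡ ηₓ d e a' b' → a ≡ a' × b ≡ b'
  ηₓ-injective d e h = η-inj d (subst-injective e h)

  ηₓ-subst : ∀ {A B A' B' X} (pA : A ≡ A') (pB : B ≡ B')
             (d : Disjoint A B) (d' : Disjoint A' B') (e : A ∪ᵒ B ≡ X) (e' : A' ∪ᵒ B' ≡ X) a b →
             ηₓ d' e' (subst F₀ pA a) (subst F₀ pB b) ≡ ηₓ d e a b
  ηₓ-subst refl refl d d' e e' a b rewrite Obj-uip d d' | Obj-uip e e' = refl

  module Refinement {P₁ P₂ Q₁ Q₂ X : Obj r} (d : Disjoint P₁ P₂) (e : P₁ ∪ᵒ P₂ ≡ X)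
                    (dQ : Disjoint Q₁ Q₂) (eQ : Q₁ ∪ᵒ Q₂ ≡ X) where

    private
      ρ : Vec (Obj r) 5
      ρ = P₁ ∷ P₂ ∷ Q₁ ∷ Q₂ ∷ X ∷ []
      decompositions : Equations 5
      decompositions = (v₀ ∩ₑ v₁ , ∅ₑ) ∷ (v₀ ∪ₑ v₁ , v₄) ∷ (v₂ ∩ₑ v₃ , ∅ₑ) ∷ (v₂ ∪ₑ v₃ , v₄) ∷ []
      given : All (Satisfiedᵒ ρ) decompositions
      given = d ∷ e ∷ dQ ∷ eQ ∷ []

    d₁ : Disjoint (P₁ ∩ᵒ Q₁) (P₁ ∩ᵒ Q₂)
    d₁ = solve decompositions ((v₀ ∩ₑ v₂) ∩ₑ (v₀ ∩ₑ v₃)) ∅ₑ tt ρ given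
    d₂ : Disjoint (P₂ ∩ᵒ Q₁) (P₂ ∩ᵒ Q₂)
    d₂ = solve decompositions ((v₁ ∩ₑ v₂) ∩ₑ (v₁ ∩ₑ v₃)) ∅ₑ tt ρ given
    e₁ : (P₁ ∩ᵒ Q₁) ∪ᵒ (P₁ ∩ᵒ Q₂) ≡ P₁
    e₁ = solve decompositions ((v₀ ∩ₑ v₂) ∪ₑ (v₀ ∩ₑ v₃)) v₀ tt ρ given
    e₂ : (P₂ ∩ᵒ Q₁) ∪ᵒ (P₂ ∩ᵒ Q₂) ≡ P₂
    e₂ = solve decompositions ((v₁ ∩ₑ v₂) ∪ₑ (v₁ ∩ₑ v₃)) v₁ tt ρ given
    d₃ : Disjoint ((P₁ ∩ᵒ Q₁) ∪ᵒ (P₁ ∩ᵒ Q₂)) ((P₂ ∩ᵒ Q₁) ∪ᵒ (P₂ ∩ᵒ Q₂))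
    d₃ = solve decompositions (((v₀ ∩ₑ v₂) ∪ₑ (v₀ ∩ₑ v₃)) ∩ₑ ((v₁ ∩ₑ v₂) ∪ₑ (v₁ ∩ₑ v₃))) ∅ₑ tt ρ given
    e₃ : ((P₁ ∩ᵒ Q₁) ∪ᵒ (P₁ ∩ᵒ Q₂)) ∪ᵒ ((P₂ ∩ᵒ Q₁) ∪ᵒ (P₂ ∩ᵒ Q₂)) ≡ X
    e₃ = solve decompositions (((v₀ ∩ₑ v₂) ∪ₑ (v₀ ∩ₑ v₃)) ∪ₑ ((v₁ ∩ₑ v₂) ∪ₑ (v₁ ∩ₑ v₃))) v₄ tt ρ given

    -- (D1) from left to right, followed by injectivity of η: if η(a, b) is
    -- also a Q₁,Q₂-product, then a and b split along Q₁, Q₂.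
    restrict : ∀ {a b a' b'} → ηₓ dQ eQ a' b' ≡ ηₓ d e a b →
               Im (P₁ ∩ᵒ Q₁) (P₁ ∩ᵒ Q₂) P₁ a × Im (P₂ ∩ᵒ Q₁) (P₂ ∩ᵒ Q₂) P₂ b
    restrict {a} {b} {a'} {b'} h
      with Equivalence.to (D1 d e dQ eQ d₁ d₂ d₃ e₃ (ηₓ d e a b)) ((a , b , tt , tt , refl) , (a' , b' , tt , tt , h))
    ... | u , w , (p , q , _ , _ , refl) , (p' , q' , _ , _ , refl) , hx
      with refl , refl ← ηₓ-injective d e (trans (ηₓ-subst e₁ e₂ d₃ d e₃ e u w) hx)
      = (d₁ , e₁ , p , q , refl) , (d₂ , e₂ , p' , q' , refl)

    extend : ∀ {a b} → Im (P₁ ∩ᵒ Q₁) (P₁ ∩ᵒ Q₂) P₁ a → Im (P₂ ∩ᵒ Q₁) (P₂ ∩ᵒ Q₂) P₂ b →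
             Im Q₁ Q₂ X (ηₓ d e a b)
    extend (dA , eA , p , q , refl) (dB , eB , p' , q' , refl)
      with Equivalence.from (D1 d e dQ eQ d₁ d₂ d₃ e₃ _)
             (η d₁ p q , η d₂ p' q' , (p , q , tt , tt , refl) , (p' , q' , tt , tt , refl) , product)
      where
      product : ηₓ d₃ e₃ (η d₁ p q) (η d₂ p' q') ≡ ηₓ d e (ηₓ dA eA p q) (ηₓ dB eB p' q')
      product rewrite Obj-uip dA d₁ | Obj-uip dB d₂ = sym (ηₓ-subst eA eB d₃ d e₃ e _ _)
    ... | _ , (a' , b' , _ , _ , h) = dQ , eQ , a' , b' , h

  split : ∀ {P₁ P₂ Q₁ Q₂ X} (d : Disjoint P₁ P₂) (e : P₁ ∪ᵒ P₂ ≡ X) {a b} →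
          Im Q₁ Q₂ X (ηₓ d e a b) →
          Im (P₁ ∩ᵒ Q₁) (P₁ ∩ᵒ Q₂) P₁ a × Im (P₂ ∩ᵒ Q₁) (P₂ ∩ᵒ Q₂) P₂ b
  split d e (dQ , eQ , _ , _ , h) = Refinement.restrict d e dQ eQ h

  merge : ∀ {P₁ P₂ Q₁ Q₂ X} (d : Disjoint P₁ P₂) (e : P₁ ∪ᵒ P₂ ≡ X)
          (dQ : Disjoint Q₁ Q₂) (eQ : Q₁ ∪ᵒ Q₂ ≡ X) {a b} →
          Im (P₁ ∩ᵒ Q₁) (P₁ ∩ᵒ Q₂) P₁ a → Im (P₂ ∩ᵒ Q₁) (P₂ ∩ᵒ Q₂) P₂ b →
          Im Q₁ Q₂ X (ηₓ d e a b)
  merge d e dQ eQ = Refinement.extend d e dQ eQ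

  -- A nonempty image forces F[∅] ≠ ∅: by (D1) for the decomposition
  -- A ∐ B and itself, a factor of the point lives in F[A ∩ B] = F[∅].
  point-of-∅ : ∀ {A B X x} → Im A B X x → F₀ ∅ᵒ
  point-of-∅ (d , e , a , b , refl) with (_ , _ , _ , c , _) , _ ← split d e (d , e , a , b , refl)
    = subst F₀ d c

  -- Given a point z of F[∅], η(-, z) : F[A] → F[A ∐ ∅] = F[A] is injective,
  -- hence onto since F[A] is finite: every element is a product with z.
  module WithPoint (z : F₀ ∅ᵒ) where

    absorbʳ : ∀ {A B X} → B ≡ ∅ᵒ → A ≡ X → ∀ x → Im A B X x
    absorbʳ {A} refl refl x = d , u , proj₁ hit , z , proj₂ hit
      where
      d : Disjoint A ∅ᵒ
      d = solve [] (v₀ ∩ₑ ∅ₑ) ∅ₑ tt (A ∷ []) []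
      u : A ∪ᵒ ∅ᵒ ≡ A
      u = solve [] (v₀ ∪ₑ ∅ₑ) v₀ tt (A ∷ []) []
      hit : Σ (F₀ A) λ a → ηₓ d u a z ≡ x
      hit = injective⇒surjective (finite A) (λ a → ηₓ d u a z) (λ h → proj₁ (ηₓ-injective d u h)) x

    absorbˡ : ∀ {A B X} → A ≡ ∅ᵒ → B ≡ X → ∀ x → Im A B X x
    absorbˡ {_} {B} refl refl x = d , u , z , proj₁ hit , proj₂ hit
      where
      d : Disjoint ∅ᵒ B
      d = solve [] (∅ₑ ∩ₑ v₀) ∅ₑ tt (B ∷ []) []
      u : ∅ᵒ ∪ᵒ B ≡ B
      u = solve [] (∅ₑ ∪ₑ v₀) v₀ tt (B ∷ []) []
      hit : Σ (F₀ B) λ b → ηₓ d u z b ≡ x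
      hit = injective⇒surjective (finite B) (λ b → ηₓ d u z b) (λ h → proj₂ (ηₓ-injective d u h)) x

module Bracketings {r m : ℕ} (F : Species r) (C : CompositionOperator F) (Ω : Fin m → Obj r)
                   (disjoint : ∀ i j → i ≢ j → Disjoint (Ω i) (Ω j)) where
  open Species F
  open CompositionFacts F C

  U : Tree m → Obj r
  U = Uᵗ F C Ω

  Separated : Tree m → Set
  Separated (leaf i)   = ⊤
  Separated (node s t) = Disjoint (U s) (U t) × Separated s × Separated t

  -- x ∈ F[X] splits along every Ωⱼ: x ∈ η(F[X ∩ Ωⱼ] × F[X ∖ Ωⱼ]) for all j.
  -- This tree-independent condition characterises every bracketing.
  Splits : (X : Obj r) → F₀ X → Set
  Splits X x = ∀ j → Im (X ∩ᵒ Ω j) (X ∖ᵒ Ω j) X x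

  Splits-subst : ∀ {X X'} (p : X ≡ X') {x} → Splits X x → Splits X' (subst F₀ p x)
  Splits-subst refl sp = sp

  module Characterisation (z : F₀ ∅ᵒ) where
    open WithPoint z

    -- Every element of a bracketing splits: a leaf F[Ωᵢ] splits trivially
    -- (one piece is empty), and (D1) carries splittings through η.
    bracket⇒splits : ∀ t {y} → Bracket F C Ω t y → Splits (U t) y
    bracket⇒splits (leaf i) {y} _ j with i ≟ᶠ j
    ... | yes refl = absorbʳ (∖-self (Ω i)) (∩-idem (Ω i)) y
    ... | no i≢j   = absorbˡ (disjoint i j i≢j) (∖-disjoint (Ω i) (Ω j) (disjoint i j i≢j)) y
    bracket⇒splits (node s t) (d , a , b , Ba , Bb , refl) j =
      merge d refl (cut-disjoint (U s ∪ᵒ U t) (Ω j)) (cut-cover (U s ∪ᵒ U t) (Ω j))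
        (Im-cong (cut-restrictˡ (U s) (U t) (Ω j)) (bracket⇒splits s Ba j))
        (Im-cong (cut-restrictʳ (U s) (U t) (Ω j)) (bracket⇒splits t Bb j))

    splits-along : ∀ s {X x} → Separated s → U s ⊆ᵒ X → Splits X x → Im (U s) (X ∖ᵒ U s) X x
    splits-along (leaf i) {X} _ sub sp = Im-cong (⊆⇒∩-swap (Ω i) X sub , refl) (sp i)
    splits-along (node s₁ s₂) {X} (_ , sep₁ , sep₂) sub sp
      with d , e , a , b , refl ← splits-along s₁ sep₁ (proj₁ (∪-⊆⁻ (U s₁) (U s₂) X sub)) sp
      with _ , b-splits ← split d e (splits-along s₂ sep₂ (proj₂ (∪-⊆⁻ (U s₁) (U s₂) X sub)) sp)
      = merge d e (complement-disjoint (U s₁ ∪ᵒ U s₂) X) (complement-cover (U s₁ ∪ᵒ U s₂) X sub)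
          (absorbʳ (∩-∖-∪ (U s₁) (U s₂) X) (⊆-∪ˡ (U s₁) (U s₂)) a)
          (Im-cong (cut-complement (U s₁) (U s₂) X) b-splits)

    splits⇒bracket : ∀ t {y} → Separated t → Splits (U t) y → Bracket F C Ω t y
    splits⇒bracket (leaf i) _ _ = tt
    splits⇒bracket (node s t) (d , sep-s , sep-t) sp
      with d' , e' , a , b , refl ←
             Im-cong (refl , ∪-∖ˡ (U s) (U t) d) (splits-along s sep-s (⊆-∪ˡ (U s) (U t)) sp)
      = d' , a , b , splits⇒bracket s sep-s split-a , splits⇒bracket t sep-t split-b
      , cong (λ e → ηₓ d' e a b) (Obj-uip refl e')
      where
      split-a : Splits (U s) a
      split-a j = Im-cong⁻ (cut-restrictˡ (U s) (U t) (Ω j)) (proj₁ (split d' e' (sp j)))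
      split-b : Splits (U t) b
      split-b j = Im-cong⁻ (cut-restrictʳ (U s) (U t) (Ω j)) (proj₂ (split d' e' (sp j)))

  disjoint-trees : ∀ s t → All (λ i → All (i ≢_) (leaves t)) (leaves s) → Disjoint (U s) (U t)
  disjoint-trees (leaf i) (leaf j) ((i≢j ∷ []) ∷ []) = disjoint i j i≢j
  disjoint-trees (leaf i) (node t₁ t₂) (i∉t ∷ []) =
    ∪-disjointʳ (U t₁) (U t₂) (Ω i)
      (disjoint-trees (leaf i) t₁ (++⁻ˡ (leaves t₁) i∉t ∷ []))
      (disjoint-trees (leaf i) t₂ (++⁻ʳ (leaves t₁) i∉t ∷ []))
  disjoint-trees (node s₁ s₂) t s∉t =
    ∪-disjointˡ (U s₁) (U s₂) (U t)
      (disjoint-trees s₁ t (++⁻ˡ (leaves s₁) s∉t))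
      (disjoint-trees s₂ t (++⁻ʳ (leaves s₁) s∉t))

  distinct⇒separated : ∀ t → AllPairs _≢_ (leaves t) → Separated t
  distinct⇒separated (leaf i)   _        = tt
  distinct⇒separated (node s t) distinct with ds , dt , s∉t ← AllPairs-++⁻ (leaves s) distinct =
    disjoint-trees s t s∉t , distinct⇒separated s ds , distinct⇒separated t dt

  bracketing⇒separated : ∀ {t} → IsBracketing t → Separated t
  bracketing⇒separated {t} b =
    distinct⇒separated t (AllPairs-resp-↭ (setoid (Fin m)) ≢-sym (resp₂ _≢_) (↭⇒↭ₛ (↭-sym b)) (allFin⁺ m))

  -- Leaves are trivial; two proper brackets are compared through Splits, the
  -- point of F[∅] needed for that being extracted from the given element.
  transfer : ∀ t t' → IsBracketing t → IsBracketing t' →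
             (e : U t ≡ ⋃ᵒ m Ω) (e' : U t' ≡ ⋃ᵒ m Ω) →
             ∀ {x} → BracketIn F C Ω t e x → BracketIn F C Ω t' e' x
  transfer _ (leaf j) _ _ _ e' {x} _ = subst F₀ (sym e') x , tt , subst-subst-sym e'
  transfer (leaf i) (node s' u') bt bt' _ _ _ = ⊥-elim (leaf-node-bracketings {s = s'} {u'} bt bt')
  transfer t@(node _ _) t'@(node _ _) bt bt' e e' {x} (y , By@(d , a , b , _ , _ , h) , refl) =
    subst F₀ (sym e') x ,
    splits⇒bracket t' (bracketing⇒separated bt')
      (Splits-subst (sym e') (Splits-subst e (bracket⇒splits t By))) ,
    subst-subst-sym e'
    where open Characterisation (point-of-∅ (d , refl , a , b , h))

-- Each bracketing is contained in every other.
lemma3p7 : (r : ℕ) → 1 ≤ r →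
    (F : Species r) (C : CompositionOperator F) → Nonempty F →
    (m : ℕ) (Ω : Fin m → Obj r) →
    (∀ i j → i ≢ j → Disjoint (Ω i) (Ω j)) →
    (t t' : Tree m) → IsBracketing t → IsBracketing t' →
    (e : Uᵗ F C Ω t ≡ ⋃ᵒ m Ω) (e' : Uᵗ F C Ω t' ≡ ⋃ᵒ m Ω) →
    (x : Species.F₀ F (⋃ᵒ m Ω)) →
    BracketIn F C Ω t e x ⇔ BracketIn F C Ω t' e' x
lemma3p7 _ _ F C _ m Ω disjoint t t' bt bt' e e' x =
  mk⇔ (transfer t t' bt bt' e e') (transfer t' t bt' bt e' e)
  where open Bracketings F C Ω disjoint
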